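{- Let $G$ be a finite, simple, connected $3$-$\gamma_{c}$-critical graph, let $S$ be a minimum vertex cut set of $G$, let $C_1, \dots, C_m$ ($m \geq 2$) be the components of $G - S$ (in any order), and set $H_1 = \bigcup_{i=1}^{\lfloor m/2 \rfloor} V(C_i)$ and $H_2 = \bigcup_{i=\lfloor m/2 \rfloor + 1}^{m} V(C_i)$. Let $I$ be a maximum independent set of $G$, $I_j = I \cap H_j$ for $j \in \{1,2\}$, and $p = |I_1 \cup I_2|$. Suppose $p \geq 3$, $|H_1| \geq 2$ and $|H_2| \geq 2$, and let $a_1, a_2, \dots, a_p$ be an ordering of the vertices of $I_1 \cup I_2$ and $x_1, x_2, \dots, x_{p-1}$ a path in $G$ with all vertices in $V(G) \setminus (I_1 \cup I_2)$ such that, for each $1 \leq i \leq p-1$, $\{a_i, x_i\}$ is a connected dominating set of $G + a_i a_{i+1}$. Then $x_i \in S \setminus I$ for every $1 \leq i \leq p-1$; in particular $|S \setminus I| \geq p - 1$.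
   Context: All graphs are finite, simple and connected. A set $D \subseteq V(G)$ is a connected dominating set of $G$ if every vertex of $G$ is in $D$ or adjacent to a vertex of $D$, and $G[D]$ is connected; $\gamma_{c}(G)$ is the minimum size of such a set. For non-adjacent $u,v$, $G+uv$ is $G$ with edge $uv$ added. $G$ is $3$-$\gamma_{c}$-critical if $\gamma_{c}(G)=3$ and $\gamma_{c}(G+uv)<3$ for every pair of non-adjacent vertices $u,v$. A vertex cut set is a set $S$ with $G - S$ disconnected; a minimum one has size equal to the connectivity $\kappa(G)$. An independent set is a set of pairwise non-adjacent vertices; a maximum one has size $\alpha(G)$. -}

module Defs where

open import Data.Nat using (ℕ; zero; suc; _≤_; _<_; _∸_; _/_; _<ᵇ_)
open import Data.Bool using (Bool; true; false; _∧_; _∨_; not)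
open import Data.Fin using (Fin; toℕ)
open import Data.Fin.Properties using () renaming (_≟_ to _≟ᶠ_)
open import Data.Fin.Subset using (Subset; _∈_; _∉_; ∣_∣; ⁅_⁆; _∪_; _∩_; _─_; ∁)
open import Data.Vec using (lookup; tabulate)
open import Data.Product using (Σ; ∃; _×_; _,_)
open import Data.Sum using (_⊎_)
open import Relation.Binary.PropositionalEquality using (_≡_)
open import Relation.Nullary using (¬_)
open import Relation.Nullary.Decidable using (⌊_⌋)

Adjacency : ℕ → Set
Adjacency n = Fin n → Fin n → Bool

IsSimple : {n : ℕ} → Adjacency n → Set
IsSimple {n} G = (∀ u v → G u v ≡ G v u) × (∀ v → G v v ≡ false)

addEdge : {n : ℕ} → Adjacency n → Fin n → Fin n → Adjacency n
addEdge G u v x y =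
  G x y ∨ (⌊ x ≟ᶠ u ⌋ ∧ ⌊ y ≟ᶠ v ⌋) ∨ (⌊ x ≟ᶠ v ⌋ ∧ ⌊ y ≟ᶠ u ⌋)

data WalkIn {n : ℕ} (G : Adjacency n) (D : Subset n) : Fin n → Fin n → Set where
  here : ∀ {u} → u ∈ D → WalkIn G D u u
  step : ∀ {u w v} → u ∈ D → G u w ≡ true → WalkIn G D w v → WalkIn G D u v

InducedConnected : {n : ℕ} → Adjacency n → Subset n → Set
InducedConnected {n} G D = ∀ (u v : Fin n) → u ∈ D → v ∈ D → WalkIn G D u v

full : {n : ℕ} → Subset n
full = tabulate (λ _ → true)

ConnectedGraph : {n : ℕ} → Adjacency n → Set
ConnectedGraph {n} G = Fin n × InducedConnected G full   -- nonempty and connected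

Dominating : {n : ℕ} → Adjacency n → Subset n → Set
Dominating {n} G D = ∀ (v : Fin n) → v ∈ D ⊎ ∃ (λ u → u ∈ D × G u v ≡ true)

IsCDS : {n : ℕ} → Adjacency n → Subset n → Set
IsCDS G D = Dominating G D × InducedConnected G D

GammaC≡ : {n : ℕ} → Adjacency n → ℕ → Set
GammaC≡ G k = ∃ (λ D → IsCDS G D × ∣ D ∣ ≡ k) × (∀ D → IsCDS G D → k ≤ ∣ D ∣)

GammaC< : {n : ℕ} → Adjacency n → ℕ → Set
GammaC< G k = ∃ (λ D → IsCDS G D × ∣ D ∣ < k)

ThreeGammaCCritical : {n : ℕ} → Adjacency n → Set
ThreeGammaCCritical {n} G =
  GammaC≡ G 3 ×
  (∀ (u v : Fin n) → ¬ (u ≡ v) → G u v ≡ false → GammaC< (addEdge G u v) 3)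

IsVertexCut : {n : ℕ} → Adjacency n → Subset n → Set
IsVertexCut G S = ∃ (λ u → ∃ (λ v → u ∉ S × v ∉ S × ¬ WalkIn G (∁ S) u v))

IsMinVertexCut : {n : ℕ} → Adjacency n → Subset n → Set
IsMinVertexCut G S = IsVertexCut G S × (∀ T → IsVertexCut G T → ∣ S ∣ ≤ ∣ T ∣)

IsIndependent : {n : ℕ} → Adjacency n → Subset n → Set
IsIndependent G I = ∀ u v → u ∈ I → v ∈ I → G u v ≡ false

IsMaxIndependent : {n : ℕ} → Adjacency n → Subset n → Set
IsMaxIndependent G I = IsIndependent G I × (∀ J → IsIndependent G J → ∣ J ∣ ≤ ∣ I ∣)

-- An ordered list of the components C_0, ..., C_{m-1} of G - S, given by a
-- labelling: vertex v ∉ S lies in component C_(label v).  Each label is used,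
-- and two vertices outside S get the same label iff they are joined by a
-- walk in G - S.  (Labels of vertices in S are irrelevant.)
IsComponentLabelling : {n : ℕ} → Adjacency n → Subset n → (m : ℕ) → (Fin n → Fin m) → Set
IsComponentLabelling {n} G S m label =
  (∀ (i : Fin m) → ∃ (λ v → v ∉ S × label v ≡ i)) ×
  (∀ (u v : Fin n) → u ∉ S → v ∉ S →
     (label u ≡ label v → WalkIn G (∁ S) u v) × (WalkIn G (∁ S) u v → label u ≡ label v))

-- H_1 = C_1 ∪ ... ∪ C_⌊m/2⌋  (0-based: labels i with i < ⌊m/2⌋)
H₁ : {n m : ℕ} → Subset n → (Fin n → Fin m) → Subset n
H₁ {n} {m} S label = tabulate (λ v → not (lookup S v) ∧ (toℕ (label v) <ᵇ m / 2))

-- H_2 = C_(⌊m/2⌋+1) ∪ ... ∪ C_m  (0-based: labels i with ⌊m/2⌋ ≤ i)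
H₂ : {n m : ℕ} → Subset n → (Fin n → Fin m) → Subset n
H₂ {n} {m} S label = tabulate (λ v → not (lookup S v) ∧ not (toℕ (label v) <ᵇ m / 2))

-- Fix i and write a = a_i, b = a_(i+1), x = x_i. Since b ∉ {a, x}, every edge
-- of G + ab used by the connected dominating set {a, x} is an edge of G
-- unless it ends in b. Hence ax ∈ E(G), so x ∉ I because a ∈ I. If moreover
-- x ∉ S, then a and x lie in one component of G - S and {a, x} dominates
-- every vertex of G - S other than b, so all of G - S except b lies in a
-- single component; but H₁ and H₂ each contain a vertex other than b, and
-- they lie in different components. The bound |S ─ I| ≥ p - 1 then follows
-- because the x_i are distinct.
module Submission where

open import Defs
open import Data.Nat using (ℕ; zero; suc; _≤_; _<_; _∸_; _/_; _<ᵇ_; z≤n; s≤s)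
open import Data.Nat.Properties using (≤-trans; <-trans; m<n⇒m<1+n; <⇒≢; n<1+n)
open import Data.Bool using (Bool; true; false; _∧_; _∨_)
open import Data.Bool.Properties using (∨-identityʳ)
open import Data.Fin using (Fin; toℕ)
open import Data.Fin.Properties using (any?) renaming (_≟_ to _≟ᶠ_)
open import Data.Fin.Subset using (Subset; _∈_; _∉_; ∣_∣; ⁅_⁆; _∪_; _∩_; _─_; _-_; _⊆_)
open import Data.Fin.Subset.Properties
  using (_∈?_; x∈⁅x⁆; x∈⁅y⁆⇒x≡y; x∈p∪q⁺; x∈p∪q⁻; x∈p∩q⁻; x∉p⇒x∈∁p;
         x∈p∧x∉q⇒x∈p─q; x∈p⇒∣p-x∣<∣p∣; p⊆q⇒∣p∣≤∣q∣; ∣⁅x⁆∣≡1)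
open import Data.Vec using (lookup; tabulate)
open import Data.Vec.Properties using ([]=⇒lookup; lookup∘tabulate)
open import Data.Product using (∃; _×_; _,_; proj₁; proj₂)
open import Data.Sum using (_⊎_; inj₁; inj₂)
open import Relation.Nullary using (¬_; Dec; yes; no; contradiction)
open import Relation.Nullary.Decidable using (⌊_⌋; _×-dec_; ¬?)
open import Relation.Binary.PropositionalEquality
  using (_≡_; _≢_; refl; sym; trans; cong; cong₂; subst; module ≡-Reasoning)

∈-tabulate⁻ : ∀ {n} (f : Fin n → Bool) v → v ∈ tabulate f → f v ≡ true
∈-tabulate⁻ f v v∈ = trans (sym (lookup∘tabulate f v)) ([]=⇒lookup v∈)

lookup≡false⇒∉ : ∀ {n} {p : Subset n} {v} → lookup p v ≡ false → v ∉ p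
lookup≡false⇒∉ eq v∈ with () ← trans (sym eq) ([]=⇒lookup v∈)

∈⁅x⁆∪⁅y⁆⁻ : ∀ {n} {x y v : Fin n} → v ∈ ⁅ x ⁆ ∪ ⁅ y ⁆ → v ≡ x ⊎ v ≡ y
∈⁅x⁆∪⁅y⁆⁻ {x = x} {y} v∈ with x∈p∪q⁻ ⁅ x ⁆ ⁅ y ⁆ v∈
... | inj₁ v∈x = inj₁ (x∈⁅y⁆⇒x≡y x v∈x)
... | inj₂ v∈y = inj₂ (x∈⁅y⁆⇒x≡y y v∈y)

∉⁅x⁆∪⁅y⁆ : ∀ {n} {x y v : Fin n} → v ≢ x → v ≢ y → v ∉ ⁅ x ⁆ ∪ ⁅ y ⁆
∉⁅x⁆∪⁅y⁆ v≢x v≢y v∈ with ∈⁅x⁆∪⁅y⁆⁻ v∈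
... | inj₁ v≡x = v≢x v≡x
... | inj₂ v≡y = v≢y v≡y

∃∈∧≢ : ∀ {n} (p : Subset n) → 2 ≤ ∣ p ∣ → (y : Fin n) → ∃ (λ v → v ∈ p × v ≢ y)
∃∈∧≢ p 2≤∣p∣ y with any? (λ v → (v ∈? p) ×-dec ¬? (v ≟ᶠ y))
... | yes witness = witness
... | no ∄ = contradiction (≤-trans 2≤∣p∣ ∣p∣≤1) λ { (s≤s ()) }
  where
  p⊆⁅y⁆ : p ⊆ ⁅ y ⁆
  p⊆⁅y⁆ {v} v∈p with v ≟ᶠ y
  ... | yes refl = x∈⁅x⁆ v
  ... | no v≢y = contradiction (v , v∈p , v≢y) ∄
  ∣p∣≤1 : ∣ p ∣ ≤ 1
  ∣p∣≤1 = subst (∣ p ∣ ≤_) (∣⁅x⁆∣≡1 y) (p⊆q⇒∣p∣≤∣q∣ p⊆⁅y⁆)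

injective⇒≤∣∣ : ∀ {n} (f : ℕ → Fin n) (q : Subset n) k →
  (∀ i j → i < k → j < k → f i ≡ f j → i ≡ j) → (∀ i → i < k → f i ∈ q) → k ≤ ∣ q ∣
injective⇒≤∣∣ f q zero _ _ = z≤n
injective⇒≤∣∣ f q (suc k) inj f∈q =
  ≤-trans (s≤s (injective⇒≤∣∣ f (q - f k) k inj′ f∈q-fk)) (x∈p⇒∣p-x∣<∣p∣ (f∈q k (n<1+n k)))
  where
  inj′ : ∀ i j → i < k → j < k → f i ≡ f j → i ≡ j
  inj′ i j i<k j<k = inj i j (m<n⇒m<1+n i<k) (m<n⇒m<1+n j<k)
  f∈q-fk : ∀ i → i < k → f i ∈ q - f k
  f∈q-fk i i<k = x∈p∧x∉q⇒x∈p─q (f∈q i (m<n⇒m<1+n i<k))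
    λ fi∈ → <⇒≢ i<k (inj i k (m<n⇒m<1+n i<k) (n<1+n k) (x∈⁅y⁆⇒x≡y (f k) fi∈))

⌊⌋∧⌊⌋≡false : ∀ {p q} {P : Set p} {Q : Set q} (P? : Dec P) (Q? : Dec Q) →
  ¬ (P × Q) → ⌊ P? ⌋ ∧ ⌊ Q? ⌋ ≡ false
⌊⌋∧⌊⌋≡false (yes p) (yes q) ¬pq = contradiction (p , q) ¬pq
⌊⌋∧⌊⌋≡false (yes _) (no _)  _   = refl
⌊⌋∧⌊⌋≡false (no _)  _       _   = refl

walkStart : ∀ {n} {G : Adjacency n} {D u v} → WalkIn G D u v → u ∈ D
walkStart (here u∈D) = u∈D
walkStart (step u∈D _ _) = u∈D

m<n∸1⇒1+m<n : ∀ {m} n → m < n ∸ 1 → suc m < n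
m<n∸1⇒1+m<n (suc n) m<n∸1 = s≤s m<n∸1

module _ {n} (G : Adjacency n) {a b : Fin n} where

  addEdge⁻ : ∀ {u v} → addEdge G a b u v ≡ true → u ≢ b → v ≢ b → G u v ≡ true
  addEdge⁻ {u} {v} e u≢b v≢b = begin
    G u v                        ≡⟨ ∨-identityʳ (G u v) ⟨
    G u v ∨ false ∨ false        ≡⟨ cong₂ (λ s t → G u v ∨ s ∨ t) uv≢ab vu≢ab ⟨
    addEdge G a b u v            ≡⟨ e ⟩
    true                         ∎
    where
    open ≡-Reasoning
    uv≢ab : ⌊ u ≟ᶠ a ⌋ ∧ ⌊ v ≟ᶠ b ⌋ ≡ false
    uv≢ab = ⌊⌋∧⌊⌋≡false (u ≟ᶠ a) (v ≟ᶠ b) (λ (_ , v≡b) → v≢b v≡b)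
    vu≢ab : ⌊ u ≟ᶠ b ⌋ ∧ ⌊ v ≟ᶠ a ⌋ ≡ false
    vu≢ab = ⌊⌋∧⌊⌋≡false (u ≟ᶠ b) (v ≟ᶠ a) (λ (u≡b , _) → u≢b u≡b)

  WalkIn-addEdge⁻ : ∀ {D u v} → b ∉ D → WalkIn (addEdge G a b) D u v → WalkIn G D u v
  WalkIn-addEdge⁻ b∉D (here u∈D) = here u∈D
  WalkIn-addEdge⁻ {D} b∉D (step u∈D e w) =
    step u∈D (addEdge⁻ e (∈D⇒≢b u∈D) (∈D⇒≢b (walkStart w))) (WalkIn-addEdge⁻ b∉D w)
    where
    ∈D⇒≢b : ∀ {v} → v ∈ D → v ≢ b
    ∈D⇒≢b v∈D refl = b∉D v∈D

  Dominating-addEdge⁻ : ∀ {D} → b ∉ D → Dominating (addEdge G a b) D →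
    ∀ v → v ≢ b → v ∈ D ⊎ ∃ (λ u → u ∈ D × G u v ≡ true)
  Dominating-addEdge⁻ b∉D dom v v≢b with dom v
  ... | inj₁ v∈D = inj₁ v∈D
  ... | inj₂ (u , u∈D , e) = inj₂ (u , u∈D , addEdge⁻ e (λ { refl → b∉D u∈D }) v≢b)

pairWalk⇒edge : ∀ {n} {G : Adjacency n} {a x v} →
  WalkIn G (⁅ a ⁆ ∪ ⁅ x ⁆) a v → v ≢ a → G a x ≡ true
pairWalk⇒edge (here _) v≢a = contradiction refl v≢a
pairWalk⇒edge (step _ e walk) v≢a with ∈⁅x⁆∪⁅y⁆⁻ (walkStart walk)
... | inj₁ refl = pairWalk⇒edge walk v≢a
... | inj₂ refl = e

inLowerHalf : ∀ {m} → Fin m → Bool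
inLowerHalf {m} i = toℕ i <ᵇ m / 2

module _ {n m} {S : Subset n} {label : Fin n → Fin m} where

  ∈H₁⁻ : ∀ {v} → v ∈ H₁ S label → v ∉ S × inLowerHalf (label v) ≡ true
  ∈H₁⁻ {v} v∈H₁ with lookup S v in S[v]≡ | inLowerHalf (label v) | ∈-tabulate⁻ _ v v∈H₁
  ... | false | true | _ = lookup≡false⇒∉ S[v]≡ , refl

  ∈H₂⁻ : ∀ {v} → v ∈ H₂ S label → v ∉ S × inLowerHalf (label v) ≡ false
  ∈H₂⁻ {v} v∈H₂ with lookup S v in S[v]≡ | inLowerHalf (label v) | ∈-tabulate⁻ _ v v∈H₂
  ... | false | false | _ = lookup≡false⇒∉ S[v]≡ , refl

  ∈I₁∪I₂⁻ : ∀ {I v} → v ∈ (I ∩ H₁ S label) ∪ (I ∩ H₂ S label) → v ∈ I × v ∉ S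
  ∈I₁∪I₂⁻ {I} v∈J with x∈p∪q⁻ (I ∩ H₁ S label) _ v∈J
  ... | inj₁ v∈I₁ = let (v∈I , v∈H₁) = x∈p∩q⁻ I _ v∈I₁ in v∈I , proj₁ (∈H₁⁻ v∈H₁)
  ... | inj₂ v∈I₂ = let (v∈I , v∈H₂) = x∈p∩q⁻ I _ v∈I₂ in v∈I , proj₁ (∈H₂⁻ v∈H₂)

  ¬sameLabel-except : 2 ≤ ∣ H₁ S label ∣ → 2 ≤ ∣ H₂ S label ∣ → ∀ b ℓ →
    ¬ (∀ v → v ∉ S → v ≢ b → label v ≡ ℓ)
  ¬sameLabel-except two₁ two₂ b ℓ constant
    with ∃∈∧≢ (H₁ S label) two₁ b | ∃∈∧≢ (H₂ S label) two₂ b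
  ... | v₁ , v₁∈H₁ , v₁≢b | v₂ , v₂∈H₂ , v₂≢b =
    let (v₁∉S , low₁) = ∈H₁⁻ v₁∈H₁
        (v₂∉S , high₂) = ∈H₂⁻ v₂∈H₂
    in contradiction (begin
      true                      ≡⟨ low₁ ⟨
      inLowerHalf (label v₁)    ≡⟨ cong inLowerHalf (constant v₁ v₁∉S v₁≢b) ⟩
      inLowerHalf ℓ             ≡⟨ cong inLowerHalf (constant v₂ v₂∉S v₂≢b) ⟨
      inLowerHalf (label v₂)    ≡⟨ high₂ ⟩
      false                     ∎) λ ()
    where open ≡-Reasoning

module _ {n m} {G : Adjacency n} {S : Subset n} {label : Fin n → Fin m}
  (components : IsComponentLabelling G S m label) where

  edge⇒sameLabel : ∀ {u v} → u ∉ S → v ∉ S → G u v ≡ true → label u ≡ label v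
  edge⇒sameLabel {u} {v} u∉S v∉S e =
    proj₂ (proj₂ components u v u∉S v∉S) (step (x∉p⇒x∈∁p u∉S) e (here (x∉p⇒x∈∁p v∉S)))

  module _ {I : Subset n} (independent : IsIndependent G I)
    (two₁ : 2 ≤ ∣ H₁ S label ∣) (two₂ : 2 ≤ ∣ H₂ S label ∣)
    {a b x : Fin n} (a∈I : a ∈ I) (a∉S : a ∉ S) (a≢b : a ≢ b) (x≢a : x ≢ a) (x≢b : x ≢ b)
    (cds : IsCDS (addEdge G a b) (⁅ a ⁆ ∪ ⁅ x ⁆)) where

    private
      D : Subset n
      D = ⁅ a ⁆ ∪ ⁅ x ⁆

      dominating : Dominating (addEdge G a b) D
      dominating = proj₁ cds

      connected : InducedConnected (addEdge G a b) D
      connected = proj₂ cds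

      b∉D : b ∉ D
      b∉D = ∉⁅x⁆∪⁅y⁆ (λ b≡a → a≢b (sym b≡a)) (λ b≡x → x≢b (sym b≡x))

    cdsPair⇒edge : G a x ≡ true
    cdsPair⇒edge = pairWalk⇒edge
      (WalkIn-addEdge⁻ G b∉D (connected a x (x∈p∪q⁺ (inj₁ (x∈⁅x⁆ a))) (x∈p∪q⁺ (inj₂ (x∈⁅x⁆ x)))))
      x≢a

    cdsPair⇒∉I : x ∉ I
    cdsPair⇒∉I x∈I = contradiction (trans (sym (independent a x a∈I x∈I)) cdsPair⇒edge) λ ()

    cdsPair⇒∈S : x ∈ S
    cdsPair⇒∈S with x ∈? S
    ... | yes x∈S = x∈S
    ... | no x∉S = contradiction labelOfx (¬sameLabel-except two₁ two₂ b (label x))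
      where
      D⊆component : ∀ {u} → u ∈ D → u ∉ S × label u ≡ label x
      D⊆component u∈D with ∈⁅x⁆∪⁅y⁆⁻ u∈D
      ... | inj₁ refl = a∉S , edge⇒sameLabel a∉S x∉S cdsPair⇒edge
      ... | inj₂ refl = x∉S , refl

      labelOfx : ∀ v → v ∉ S → v ≢ b → label v ≡ label x
      labelOfx v v∉S v≢b with Dominating-addEdge⁻ G b∉D dominating v v≢b
      ... | inj₁ v∈D = proj₂ (D⊆component v∈D)
      ... | inj₂ (u , u∈D , uv∈E) =
        let (u∉S , ℓu≡ℓx) = D⊆component u∈D in trans (sym (edge⇒sameLabel u∉S v∉S uv∈E)) ℓu≡ℓx

    cdsPair⇒∈S×∉I : x ∈ S × x ∉ I
    cdsPair⇒∈S×∉I = cdsPair⇒∈S , cdsPair⇒∉I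

lemma3p1 : {n : ℕ} (G : Adjacency n) → IsSimple G → ConnectedGraph G →
  ThreeGammaCCritical G →
  (S : Subset n) → IsMinVertexCut G S →
  (m : ℕ) → 2 ≤ m → (label : Fin n → Fin m) → IsComponentLabelling G S m label →
  (I : Subset n) → IsMaxIndependent G I →
  let I₁ = I ∩ H₁ S label
      I₂ = I ∩ H₂ S label
      J = I₁ ∪ I₂
      p = ∣ J ∣
  in 3 ≤ p → 2 ≤ ∣ H₁ S label ∣ → 2 ≤ ∣ H₂ S label ∣ →
  -- a_0, ..., a_(p-1): an ordering of the vertices of I₁ ∪ I₂
  (a : ℕ → Fin n) →
  (∀ i j → i < p → j < p → a i ≡ a j → i ≡ j) →
  (∀ i → i < p → a i ∈ J) →
  (∀ v → v ∈ J → ∃ (λ i → i < p × a i ≡ v)) →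
  -- x_0, ..., x_(p-2): a path in G avoiding I₁ ∪ I₂
  (x : ℕ → Fin n) →
  (∀ i j → i < p ∸ 1 → j < p ∸ 1 → x i ≡ x j → i ≡ j) →
  (∀ i → suc i < p ∸ 1 → G (x i) (x (suc i)) ≡ true) →
  (∀ i → i < p ∸ 1 → x i ∉ J) →
  (∀ i → i < p ∸ 1 → IsCDS (addEdge G (a i) (a (suc i))) (⁅ a i ⁆ ∪ ⁅ x i ⁆)) →
  (∀ i → i < p ∸ 1 → x i ∈ S × x i ∉ I) × (p ∸ 1 ≤ ∣ S ─ I ∣)
lemma3p1 G _ _ _ S _ _ _ label components I (independent , _) _ two₁ two₂
         a a-injective a∈J _ x x-injective _ x∉J cds =
  x∈S×∉I , injective⇒≤∣∣ x (S ─ I) _ x-injective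
             (λ i i<p-1 → let (x∈S , x∉I) = x∈S×∉I i i<p-1 in x∈p∧x∉q⇒x∈p─q x∈S x∉I)
  where
  J : Subset _
  J = (I ∩ H₁ S label) ∪ (I ∩ H₂ S label)

  x∈S×∉I : ∀ i → i < ∣ J ∣ ∸ 1 → x i ∈ S × x i ∉ I
  x∈S×∉I i i<p-1 = let (aᵢ∈I , aᵢ∉S) = ∈I₁∪I₂⁻ {S = S} {label = label} (a∈J i i<p) in
    cdsPair⇒∈S×∉I components independent two₁ two₂ aᵢ∈I aᵢ∉S aᵢ≢aᵢ₊₁ xᵢ≢aᵢ xᵢ≢aᵢ₊₁ (cds i i<p-1)
    where
    1+i<p : suc i < ∣ J ∣
    1+i<p = m<n∸1⇒1+m<n ∣ J ∣ i<p-1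
    i<p : i < ∣ J ∣
    i<p = <-trans (n<1+n i) 1+i<p
    aᵢ≢aᵢ₊₁ : a i ≢ a (suc i)
    aᵢ≢aᵢ₊₁ e = <⇒≢ (n<1+n i) (a-injective i (suc i) i<p 1+i<p e)
    xᵢ≢aᵢ : x i ≢ a i
    xᵢ≢aᵢ e = x∉J i i<p-1 (subst (_∈ J) (sym e) (a∈J i i<p))
    xᵢ≢aᵢ₊₁ : x i ≢ a (suc i)
    xᵢ≢aᵢ₊₁ e = x∉J i i<p-1 (subst (_∈ J) (sym e) (a∈J (suc i) 1+i<p))
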